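{- Let $G$ and $H$ be non-trivial connected graphs with $|V(H)|\ge 3$, and let $f$ be a $2$-rainbow dominating function of $G\circ H$ of minimum weight, inducing the partition $(V_\emptyset,V_1,V_2,V_{12})$ of $V(G\circ H)$. Then both $\pi_G(V_1\cup V_{12})$ and $\pi_G(V_2\cup V_{12})$ are dominating sets of $G$.
   Context: All graphs are finite and simple; non-trivial means at least two vertices. A $2$-rainbow dominating function of a graph $X$ is a map $f\colon V(X)\to 2^{\{1,2\}}$ such that for every vertex $v$ with $f(v)=\emptyset$ we have $\bigcup_{u\in N(v)} f(u)=\{1,2\}$; its weight is $\|f\|=\sum_v |f(v)|$. For such $f$, $V_\emptyset,V_1,V_2,V_{12}$ denote the sets of vertices $v$ with $f(v)=\emptyset,\{1\},\{2\},\{1,2\}$ respectively. The lexicographic product $G\circ H$ has vertex set $V(G)\times V(H)$, with $(g_1,h_1)$ adjacent to $(g_2,h_2)$ iff $g_1g_2\in E(G)$, or $g_1=g_2$ and $h_1h_2\in E(H)$. $\pi_G\colon V(G\circ H)\to V(G)$ is the projection $\pi_G(g,h)=g$. A set $D\subseteq V(G)$ dominates $G$ if every vertex of $G$ is in $D$ or adjacent to a vertex of $D$. -}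

module Defs where

open import Data.Nat using (ℕ; zero; suc; _+_; _≤_)
open import Data.Fin using (Fin)
open import Data.List using (List; map; allFin)
open import Data.Nat.ListAction using (sum)
open import Data.Product using (Σ; ∃; ∃-syntax; _×_; _,_)
open import Data.Sum using (_⊎_)
open import Relation.Binary.PropositionalEquality using (_≡_)
open import Relation.Nullary using (¬_)

record Graph : Set₁ where
  field
    n      : ℕ
    Adj    : Fin n → Fin n → Set
    sym    : ∀ {u v} → Adj u v → Adj v u
    irrefl : ∀ {v} → ¬ Adj v v

open Graph public

data Reach (G : Graph) : Fin (n G) → Fin (n G) → Set where
  here : ∀ {v} → Reach G v v
  step : ∀ {u w v} → Adj G u w → Reach G w v → Reach G u v

Connected : Graph → Set
Connected G = ∀ u v → Reach G u v

NonTrivial : Graph → Set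
NonTrivial G = 2 ≤ n G

-- The subsets of {1,2}: ∅, {1}, {2}, {1,2}.
data Label : Set where
  ∅ one two both : Label

∣_∣ˡ : Label → ℕ
∣ ∅ ∣ˡ = 0
∣ one ∣ˡ = 1
∣ two ∣ˡ = 1
∣ both ∣ˡ = 2

data Has1 : Label → Set where
  h1-one  : Has1 one
  h1-both : Has1 both

data Has2 : Label → Set where
  h2-two  : Has2 two
  h2-both : Has2 both

LexAdj : (G H : Graph) → Fin (n G) × Fin (n H) → Fin (n G) × Fin (n H) → Set
LexAdj G H (g₁ , h₁) (g₂ , h₂) = Adj G g₁ g₂ ⊎ (g₁ ≡ g₂ × Adj H h₁ h₂)

IsRDF : {V : Set} → (V → V → Set) → (V → Label) → Set
IsRDF {V} E f = ∀ v → f v ≡ ∅ →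
  (∃[ u ] (E v u × Has1 (f u))) × (∃[ u ] (E v u × Has2 (f u)))

lexWeight : (G H : Graph) → (Fin (n G) × Fin (n H) → Label) → ℕ
lexWeight G H f =
  sum (map (λ g → sum (map (λ h → ∣ f (g , h) ∣ˡ) (allFin (n H)))) (allFin (n G)))

IsLexRDF : (G H : Graph) → (Fin (n G) × Fin (n H) → Label) → Set
IsLexRDF G H f = IsRDF (LexAdj G H) f

IsMinLexRDF : (G H : Graph) → (Fin (n G) × Fin (n H) → Label) → Set
IsMinLexRDF G H f =
  IsLexRDF G H f × (∀ f′ → IsLexRDF G H f′ → lexWeight G H f ≤ lexWeight G H f′)

Dominates : (G : Graph) → (Fin (n G) → Set) → Set
Dominates G D = ∀ v → D v ⊎ ∃[ u ] (Adj G v u × D u)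

projG : (G H : Graph) → (Fin (n G) × Fin (n H) → Set) → Fin (n G) → Set
projG G H S g = ∃[ h ] S (g , h)

module Submission where

-- Call g ∈ V(G) dominated by colour 1 if colour 1 occurs in the row {g} × V(H) or in a neighbouring
-- row. An ∅-vertex of row g needs a colour-1 neighbour, which lies in row g or in a neighbouring row;
-- so if g is not dominated by colour 1, row g is labelled {2} throughout. Since H is connected with
-- at least three vertices, it contains a cherry: a centre with two distinct neighbours. Relabelling
-- row g by {1,2} on the centre, ∅ on the two leaves and {2} elsewhere lowers the weight by one and
-- keeps f rainbow dominating, because a vertex outside row g adjacent to one vertex of the row is
-- adjacent to all of it. This contradicts minimality. Colour 2 follows by swapping the colours.

open import Defs hiding (sym)
open import Data.Nat using (ℕ; suc; _+_; _≤_; _<_; s≤s; z≤n)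
open import Data.Nat.Properties
  using (+-0-commutativeMonoid; +-comm; +-identityʳ; +-cancelʳ-<; +-monoʳ-<; ≤-trans; <⇒≱; n≤1+n; m<m+n;
         module ≤-Reasoning)
open import Algebra.Properties.CommutativeMonoid.Sum +-0-commutativeMonoid
  using (sum-remove; sum-cong-≗) renaming (sum to ∑)
open import Data.Nat.ListAction as List using ()
open import Data.Nat.Tactic.RingSolver using (solve-∀)
open import Data.Fin using (Fin; zero; suc; fromℕ<; punchIn; punchOut)
open import Data.Fin.Properties using (_≟_; any?; punchInᵢ≢i; punchIn-injective; punchIn-punchOut)
open import Data.List using (map; allFin; tabulate)
open import Data.List.Properties using (map-tabulate; map-cong)
open import Data.Vec.Functional using (updateAt)
open import Data.Vec.Functional.Properties using (updateAt-updates; updateAt-minimal)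
open import Data.Product using (∃-syntax; _×_; _,_; proj₁; proj₂; curry)
open import Data.Sum using (_⊎_; inj₁; inj₂)
open import Function using (_∘_; id; const; case_of_)
open import Relation.Nullary using (¬_; Dec; yes; no; contradiction)
open import Relation.Nullary.Decidable using (_⊎-dec_)
open import Relation.Unary using (Decidable)
open import Relation.Binary.PropositionalEquality
  using (_≡_; _≢_; refl; sym; trans; cong; subst; subst₂; module ≡-Reasoning)

∑-differ-at : ∀ {k} (t u : Fin k → ℕ) (i : Fin k) →
              (∀ j → j ≢ i → t j ≡ u j) → ∑ t + u i ≡ ∑ u + t i
∑-differ-at {suc k} t u i agree = begin
  ∑ t + u i                        ≡⟨ cong (_+ u i) (sum-remove {i = i} t) ⟩
  (t i + ∑ (t ∘ punchIn i)) + u i  ≡⟨ cong (λ s → (t i + s) + u i) rest-agrees ⟩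
  (t i + ∑ (u ∘ punchIn i)) + u i  ≡⟨ exchange (t i) (∑ (u ∘ punchIn i)) (u i) ⟩
  (u i + ∑ (u ∘ punchIn i)) + t i  ≡⟨ cong (_+ t i) (sum-remove {i = i} u) ⟨
  ∑ u + t i                        ∎
  where
  open ≡-Reasoning
  rest-agrees : ∑ (t ∘ punchIn i) ≡ ∑ (u ∘ punchIn i)
  rest-agrees = sum-cong-≗ (λ j → agree (punchIn i j) (punchInᵢ≢i i j))
  exchange : ∀ a b c → (a + b) + c ≡ (c + b) + a
  exchange = solve-∀

∑-updateAt : ∀ {k} {A : Set} (w : A → ℕ) (r : Fin k → A) (i : Fin k) (x : A) →
             ∑ (w ∘ updateAt r i (const x)) + w (r i) ≡ ∑ (w ∘ r) + w x
∑-updateAt w r i x = begin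
  ∑ (w ∘ updateAt r i (const x)) + w (r i) ≡⟨ ∑-differ-at (w ∘ updateAt r i (const x)) (w ∘ r) i agree ⟩
  ∑ (w ∘ r) + w (updateAt r i (const x) i) ≡⟨ cong (λ y → ∑ (w ∘ r) + w y) (updateAt-updates i r) ⟩
  ∑ (w ∘ r) + w x                          ∎
  where
  open ≡-Reasoning
  agree : ∀ j → j ≢ i → w (updateAt r i (const x) j) ≡ w (r j)
  agree j j≢i = cong w (updateAt-minimal j i r j≢i)

sum-map-allFin : ∀ k (a : Fin k → ℕ) → List.sum (map a (allFin k)) ≡ ∑ a
sum-map-allFin k a = trans (cong List.sum (map-tabulate id a)) (sum-tabulate k a)
  where
  sum-tabulate : ∀ k (a : Fin k → ℕ) → List.sum (tabulate a) ≡ ∑ a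
  sum-tabulate 0       a = refl
  sum-tabulate (suc k) a = cong (a zero +_) (sum-tabulate k (a ∘ suc))

rowWeight : ∀ {k} → (Fin k → Label) → ℕ
rowWeight r = ∑ (∣_∣ˡ ∘ r)

swap : Label → Label
swap ∅    = ∅
swap one  = two
swap two  = one
swap both = both

∣swap∣ : ∀ l → ∣ swap l ∣ˡ ≡ ∣ l ∣ˡ
∣swap∣ ∅    = refl
∣swap∣ one  = refl
∣swap∣ two  = refl
∣swap∣ both = refl

swap-∅ : ∀ {l} → swap l ≡ ∅ → l ≡ ∅
swap-∅ {∅} _ = refl

Has1⇒Has2-swap : ∀ {l} → Has1 l → Has2 (swap l)
Has1⇒Has2-swap h1-one  = h2-two
Has1⇒Has2-swap h1-both = h2-both

Has2⇒Has1-swap : ∀ {l} → Has2 l → Has1 (swap l)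
Has2⇒Has1-swap h2-two  = h1-one
Has2⇒Has1-swap h2-both = h1-both

Has1-swap⇒Has2 : ∀ {l} → Has1 (swap l) → Has2 l
Has1-swap⇒Has2 {two}  h1-one  = h2-two
Has1-swap⇒Has2 {both} h1-both = h2-both

Has1? : Decidable Has1
Has1? ∅    = no λ ()
Has1? one  = yes h1-one
Has1? two  = no λ ()
Has1? both = yes h1-both

≡∅? : (l : Label) → Dec (l ≡ ∅)
≡∅? ∅    = yes refl
≡∅? one  = no λ ()
≡∅? two  = no λ ()
≡∅? both = no λ ()

¬Has1∧≢∅⇒≡two : ∀ {l} → ¬ Has1 l → l ≢ ∅ → l ≡ two
¬Has1∧≢∅⇒≡two {∅}    _    l≢∅ = contradiction refl l≢∅
¬Has1∧≢∅⇒≡two {one}  ¬has _   = contradiction h1-one ¬has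
¬Has1∧≢∅⇒≡two {two}  _    _   = refl
¬Has1∧≢∅⇒≡two {both} ¬has _   = contradiction h1-both ¬has

swap-isRDF : ∀ {V : Set} {E : V → V → Set} {f : V → Label} → IsRDF E f → IsRDF E (swap ∘ f)
swap-isRDF rdf v swap-fv≡∅ with rdf v (swap-∅ swap-fv≡∅)
... | (u₁ , v~u₁ , has1) , (u₂ , v~u₂ , has2) =
  (u₂ , v~u₂ , Has2⇒Has1-swap has2) , (u₁ , v~u₁ , Has1⇒Has2-swap has1)

Adj⇒≢ : ∀ (G : Graph) {u v} → Adj G u v → u ≢ v
Adj⇒≢ G u~v refl = irrefl G u~v

crossing-edge : ∀ (G : Graph) {P : Fin (n G) → Set} → Decidable P → ∀ {u v} →
                ¬ P u → P v → Reach G u v → ∃[ x ] ∃[ y ] (¬ P x × P y × Adj G x y)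
crossing-edge G P? ¬Pu Pv here = contradiction Pv ¬Pu
crossing-edge G P? {u} ¬Pu Pv (step {w = w} u~w w⇝v) with P? w
... | yes Pw  = u , w , ¬Pu , Pw , u~w
... | no  ¬Pw = crossing-edge G P? ¬Pw Pv w⇝v

avoiding₁ : ∀ {k} → 2 ≤ k → (a : Fin k) → ∃[ b ] b ≢ a
avoiding₁ (s≤s (s≤s _)) a = punchIn a zero , punchInᵢ≢i a zero

avoiding₂ : ∀ {k} → 3 ≤ k → (a b : Fin k) → ∃[ c ] (c ≢ a × c ≢ b)
avoiding₂ (s≤s 2≤k) a b with a ≟ b
... | yes refl = let c , c≢a = avoiding₁ (≤-trans 2≤k (n≤1+n _)) a in c , c≢a , c≢a
... | no  a≢b  = punchIn a c′ , punchInᵢ≢i a c′ , c≢b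
  where
  b′ = punchOut a≢b
  c′ = proj₁ (avoiding₁ 2≤k b′)
  c≢b : punchIn a c′ ≢ b
  c≢b c≡b = proj₂ (avoiding₁ 2≤k b′)
    (punchIn-injective a c′ b′ (trans c≡b (sym (punchIn-punchOut a≢b))))

record Cherry (G : Graph) : Set where
  field
    centre leaf₁ leaf₂ : Fin (n G)
    leaf₁~centre       : Adj G leaf₁ centre
    leaf₂~centre       : Adj G leaf₂ centre
    leaf₁≢leaf₂        : leaf₁ ≢ leaf₂

connected⇒neighbour : ∀ (G : Graph) → Connected G → NonTrivial G → (a : Fin (n G)) → ∃[ w ] Adj G w a
connected⇒neighbour G connected 2≤n a with avoiding₁ 2≤n a
... | b , b≢a with crossing-edge G (_≟ a) b≢a refl (connected b a)
...   | w , _ , _ , refl , w~a = w , w~a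

-- A walk from a third vertex into an edge {a , w} enters it along an edge x y, and y is the centre
-- of a cherry whose leaves are x and the other end of the edge.
edge⇒cherry : ∀ (G : Graph) → Connected G → 3 ≤ n G → ∀ {a w} → Adj G w a → Cherry G
edge⇒cherry G connected 3≤n {a} {w} w~a with avoiding₂ 3≤n a w
... | c , c≢a , c≢w = cherry (crossing-edge G (λ x → (x ≟ a) ⊎-dec (x ≟ w)) c∉aw (inj₁ refl) (connected c a))
  where
  c∉aw : ¬ (c ≡ a ⊎ c ≡ w)
  c∉aw (inj₁ c≡a) = c≢a c≡a
  c∉aw (inj₂ c≡w) = c≢w c≡w
  cherry : ∃[ x ] ∃[ y ] (¬ (x ≡ a ⊎ x ≡ w) × (y ≡ a ⊎ y ≡ w) × Adj G x y) → Cherry G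
  cherry (x , _ , x∉aw , inj₁ refl , x~a) =
    record { centre = a ; leaf₁ = w ; leaf₂ = x ; leaf₁~centre = w~a ; leaf₂~centre = x~a
           ; leaf₁≢leaf₂ = λ w≡x → x∉aw (inj₂ (sym w≡x)) }
  cherry (x , _ , x∉aw , inj₂ refl , x~w) =
    record { centre = w ; leaf₁ = a ; leaf₂ = x ; leaf₁~centre = Graph.sym G w~a ; leaf₂~centre = x~w
           ; leaf₁≢leaf₂ = λ a≡x → x∉aw (inj₁ (sym a≡x)) }

connected⇒cherry : ∀ (G : Graph) → Connected G → 3 ≤ n G → Cherry G
connected⇒cherry G connected 3≤n =
  edge⇒cherry G connected 3≤n (proj₂ (connected⇒neighbour G connected 2≤n (fromℕ< 2≤n)))
  where
  2≤n : 2 ≤ n G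
  2≤n = ≤-trans (n≤1+n 2) 3≤n

module CherryRow {H : Graph} (ch : Cherry H) where
  open Cherry ch

  twoRow centredRow cherryRow′ cherryRow : Fin (n H) → Label
  twoRow     = const two
  centredRow = updateAt twoRow centre (const both)
  cherryRow′ = updateAt centredRow leaf₁ (const ∅)
  cherryRow  = updateAt cherryRow′ leaf₂ (const ∅)

  cherryRow-off-leaves : ∀ {h} → h ≢ leaf₁ → h ≢ leaf₂ → cherryRow h ≡ centredRow h
  cherryRow-off-leaves {h} h≢l₁ h≢l₂ =
    trans (updateAt-minimal h leaf₂ cherryRow′ h≢l₂) (updateAt-minimal h leaf₁ centredRow h≢l₁)

  centredRow-≢∅ : ∀ h → centredRow h ≢ ∅
  centredRow-≢∅ h with h ≟ centre
  ... | yes refl = λ ≡∅ → case (trans (sym (updateAt-updates centre twoRow)) ≡∅) of λ ()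
  ... | no h≢c   = λ ≡∅ → case (trans (sym (updateAt-minimal h centre twoRow h≢c)) ≡∅) of λ ()

  cherryRow-centre : cherryRow centre ≡ both
  cherryRow-centre = trans (cherryRow-off-leaves (Adj⇒≢ H leaf₁~centre ∘ sym) (Adj⇒≢ H leaf₂~centre ∘ sym))
                           (updateAt-updates centre twoRow)

  cherryRow-∅ : ∀ h → cherryRow h ≡ ∅ → Adj H h centre
  cherryRow-∅ h ≡∅ with h ≟ leaf₁ | h ≟ leaf₂
  ... | yes refl | _        = leaf₁~centre
  ... | no _     | yes refl = leaf₂~centre
  ... | no h≢l₁  | no h≢l₂  = contradiction (trans (sym (cherryRow-off-leaves h≢l₁ h≢l₂)) ≡∅) (centredRow-≢∅ h)

  cherryRow-lighter : rowWeight cherryRow < rowWeight twoRow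
  cherryRow-lighter = +-cancelʳ-< 2 _ _ (begin-strict
    rowWeight cherryRow + 2     ≡⟨ +-comm _ 2 ⟩
    2 + rowWeight cherryRow     ≤⟨ s≤s (clearing-lighter cherryRow′ leaf₂ leaf₂-two) ⟩
    suc (rowWeight cherryRow′)  ≤⟨ clearing-lighter centredRow leaf₁ leaf₁-two ⟩
    rowWeight centredRow        <⟨ m<m+n _ (s≤s z≤n) ⟩
    rowWeight centredRow + 1    ≡⟨ ∑-updateAt ∣_∣ˡ twoRow centre both ⟩
    rowWeight twoRow + 2        ∎)
    where
    open ≤-Reasoning
    leaf₁-two : centredRow leaf₁ ≡ two
    leaf₁-two = updateAt-minimal leaf₁ centre twoRow (Adj⇒≢ H leaf₁~centre)
    leaf₂-two : cherryRow′ leaf₂ ≡ two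
    leaf₂-two = trans (updateAt-minimal leaf₂ leaf₁ centredRow (leaf₁≢leaf₂ ∘ sym))
                      (updateAt-minimal leaf₂ centre twoRow (Adj⇒≢ H leaf₂~centre))
    clearing-lighter : ∀ r i → r i ≡ two → rowWeight (updateAt r i (const ∅)) < rowWeight r
    clearing-lighter r i ri≡two = begin-strict
      rowWeight r′               <⟨ m<m+n _ (s≤s z≤n) ⟩
      rowWeight r′ + ∣ two ∣ˡ    ≡⟨ cong (λ l → rowWeight r′ + ∣ l ∣ˡ) ri≡two ⟨
      rowWeight r′ + ∣ r i ∣ˡ    ≡⟨ ∑-updateAt ∣_∣ˡ r i ∅ ⟩
      rowWeight r + 0            ≡⟨ +-identityʳ _ ⟩
      rowWeight r                ∎
      where
      r′ = updateAt r i (const ∅)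

module _ (G H : Graph) where

  Vertex : Set
  Vertex = Fin (n G) × Fin (n H)

  weight : (Vertex → Label) → ℕ
  weight f = ∑ λ g → rowWeight (curry f g)

  lexWeight≡weight : ∀ f → lexWeight G H f ≡ weight f
  lexWeight≡weight f =
    trans (cong List.sum (map-cong (λ g → sum-map-allFin (n H) (λ h → ∣ f (g , h) ∣ˡ)) (allFin (n G))))
          (sum-map-allFin (n G) (λ g → rowWeight (curry f g)))

  lexWeight-swap : ∀ f → lexWeight G H (swap ∘ f) ≡ lexWeight G H f
  lexWeight-swap f = cong List.sum (map-cong
    (λ g → cong List.sum (map-cong (λ h → ∣swap∣ (f (g , h))) (allFin (n H)))) (allFin (n G)))

  replaceRow : (Vertex → Label) → Fin (n G) → (Fin (n H) → Label) → Vertex → Label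
  replaceRow f g r (x , h) = updateAt (curry f) g (const r) x h

  replaceRow-on : ∀ f g r h → replaceRow f g r (g , h) ≡ r h
  replaceRow-on f g r h = cong (λ row → row h) (updateAt-updates g (curry f))

  replaceRow-off : ∀ f g r {x} h → x ≢ g → replaceRow f g r (x , h) ≡ f (x , h)
  replaceRow-off f g r {x} h x≢g = cong (λ row → row h) (updateAt-minimal x g (curry f) x≢g)

  weight-replaceRow : ∀ f g r → weight (replaceRow f g r) + rowWeight (curry f g) ≡ weight f + rowWeight r
  weight-replaceRow f g r = ∑-updateAt rowWeight (curry f) g r

  LexAdj-whole-row : ∀ {x h g k} → x ≢ g → LexAdj G H (x , h) (g , k) → ∀ k′ → LexAdj G H (x , h) (g , k′)
  LexAdj-whole-row x≢g (inj₁ x~g)      _ = inj₁ x~g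
  LexAdj-whole-row x≢g (inj₂ (x≡g , _)) _ = contradiction x≡g x≢g

  replaceRow-isRDF : ∀ {f} → IsLexRDF G H f → ∀ g r c → r c ≡ both → (∀ h → r h ≡ ∅ → Adj H h c) →
                     IsLexRDF G H (replaceRow f g r)
  replaceRow-isRDF {f} rdf g r c rc≡both ∅⇒~c = rainbow
    where
    f′ = replaceRow f g r
    c-both : f′ (g , c) ≡ both
    c-both = trans (replaceRow-on f g r c) rc≡both
    rainbow : IsLexRDF G H f′
    rainbow (x , h) f′xh≡∅ with x ≟ g
    ... | yes refl = ((g , c) , x~c , subst Has1 (sym c-both) h1-both) ,
                     ((g , c) , x~c , subst Has2 (sym c-both) h2-both)
      where
      x~c : LexAdj G H (g , h) (g , c)
      x~c = inj₂ (refl , ∅⇒~c h (trans (sym (replaceRow-on f g r h)) f′xh≡∅))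
    ... | no x≢g with rdf (x , h) (trans (sym (replaceRow-off f g r h x≢g)) f′xh≡∅)
    ...   | has1 , has2 = keep Has1 h1-both has1 , keep Has2 h2-both has2
      where
      keep : ∀ (P : Label → Set) → P both → ∃[ u ] (LexAdj G H (x , h) u × P (f u)) →
             ∃[ u ] (LexAdj G H (x , h) u × P (f′ u))
      keep P Pboth ((y , k) , adj , Pfu) with y ≟ g
      ... | yes refl = (g , c) , LexAdj-whole-row x≢g adj c , subst P (sym c-both) Pboth
      ... | no y≢g   = (y , k) , adj , subst P (sym (replaceRow-off f g r k y≢g)) Pfu

  row-dominated-or-all-two : ∀ {f} → IsLexRDF G H f → ∀ g →
    (projG G H (Has1 ∘ f) g ⊎ ∃[ u ] (Adj G g u × projG G H (Has1 ∘ f) u)) ⊎ (∀ h → f (g , h) ≡ two)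
  row-dominated-or-all-two {f} rdf g with any? (λ h → Has1? (f (g , h)))
  ... | yes has1 = inj₁ (inj₁ has1)
  ... | no ¬has1 with any? (λ h → ≡∅? (f (g , h)))
  ...   | no ¬empty = inj₂ λ h → ¬Has1∧≢∅⇒≡two (¬has1 ∘ (h ,_)) (¬empty ∘ (h ,_))
  ...   | yes (h , empty) with proj₁ (rdf (g , h) empty)
  ...     | (y , k) , inj₁ g~y , has1       = inj₁ (inj₂ (y , g~y , k , has1))
  ...     | (_ , k) , inj₂ (refl , _) , has1 = inj₁ (inj₁ (k , has1))

  all-two-row-not-minimal : ∀ {f} → IsMinLexRDF G H f → Cherry H → ∀ g → ¬ (∀ h → f (g , h) ≡ two)
  all-two-row-not-minimal {f} (rdf , minimal) ch g all-two =
    <⇒≱ lighter (minimal f′ (replaceRow-isRDF rdf g cherryRow centre cherryRow-centre cherryRow-∅))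
    where
    open Cherry ch
    open CherryRow ch
    f′ = replaceRow f g cherryRow
    row-g : rowWeight (curry f g) ≡ rowWeight twoRow
    row-g = sum-cong-≗ (cong ∣_∣ˡ ∘ all-two)
    lighter : lexWeight G H f′ < lexWeight G H f
    lighter = subst₂ _<_ (sym (lexWeight≡weight f′)) (sym (lexWeight≡weight f))
      (+-cancelʳ-< (rowWeight twoRow) _ _ (begin-strict
        weight f′ + rowWeight twoRow    ≡⟨ cong (weight f′ +_) row-g ⟨
        weight f′ + rowWeight (curry f g) ≡⟨ weight-replaceRow f g cherryRow ⟩
        weight f + rowWeight cherryRow  <⟨ +-monoʳ-< (weight f) cherryRow-lighter ⟩
        weight f + rowWeight twoRow     ∎))
      where open ≤-Reasoning

  Has1-dominates : ∀ {f} → IsMinLexRDF G H f → Cherry H → Dominates G (projG G H (Has1 ∘ f))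
  Has1-dominates min@(rdf , _) ch g with row-dominated-or-all-two rdf g
  ... | inj₁ dominated = dominated
  ... | inj₂ all-two   = contradiction all-two (all-two-row-not-minimal min ch g)

  swap-isMinLexRDF : ∀ {f} → IsMinLexRDF G H f → IsMinLexRDF G H (swap ∘ f)
  swap-isMinLexRDF {f} (rdf , minimal) = swap-isRDF rdf , λ f′ rdf′ →
    subst₂ _≤_ (sym (lexWeight-swap f)) (lexWeight-swap f′) (minimal (swap ∘ f′) (swap-isRDF rdf′))

  Has2-dominates : ∀ {f} → IsMinLexRDF G H f → Cherry H → Dominates G (projG G H (Has2 ∘ f))
  Has2-dominates min ch g with Has1-dominates (swap-isMinLexRDF min) ch g
  ... | inj₁ (h , has1)            = inj₁ (h , Has1-swap⇒Has2 has1)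
  ... | inj₂ (u , g~u , h , has1)  = inj₂ (u , g~u , h , Has1-swap⇒Has2 has1)

lemma6 : (G H : Graph) → NonTrivial G → NonTrivial H → Connected G → Connected H →
    3 ≤ n H → (f : Fin (n G) × Fin (n H) → Label) → IsMinLexRDF G H f →
    Dominates G (projG G H (λ x → Has1 (f x))) × Dominates G (projG G H (λ x → Has2 (f x)))
lemma6 G H _ _ _ connected 3≤n f min = Has1-dominates G H min ch , Has2-dominates G H min ch
  where
  ch = connected⇒cherry H connected 3≤n
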